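{- Let $(p\colon\mathbb{E}\to\mathbb{B},O,\Omega)$ and $(q\colon\mathbb{F}\to\mathbb{C},O',\Pi)$ be $\mathbf{CLat}_\sqcap$-fibrations with truth values indexed by the one-point category $A=1$, $F\colon\mathbb{B}\to\mathbb{C}$ and $\tau\colon F(O)\to O'$. Then for every $P\in\mathbb{E}$, $$F^{\Omega,\Pi}_{\tau}(P)=\bigwedge_{k\in\mathbb{E}(P,\Omega)}\bigl(F(pk)\bigr)^*\bigl(F^{\Omega,\Pi}_{\tau}(\Omega)\bigr),$$ i.e. $F^{\Omega,\Pi}_{\tau}=R^{F^{\Omega,\Pi}_{\tau}\Omega}_{q}\circ\mathrm{Sp}^1(F,\mathrm{id})\circ L^{\Omega}_{p}$.
   Context: A $\mathbf{CLat}_\sqcap$-fibration has complete-lattice fibers (order $\sqsubseteq$, meet $\bigwedge$) and meet-preserving reindexing $f^*$; truth values mean objects $\Omega\in\mathbb{E}$ with $p\Omega=O$ and $\Pi\in\mathbb{F}$ with $q\Pi=O'$. The codensity lifting is $F^{\Omega,\Pi}_{\tau}(P)=\bigwedge_{k\in\mathbb{E}(P,\Omega)}(\tau\circ F(pk))^*\Pi$; note $F^{\Omega,\Pi}_{\tau}(\Omega)$ lies over $F(O)$. Here $L^{\Omega}_p(P)=(pP,\{pk\mid k\in\mathbb{E}(P,\Omega)\})$, $\mathrm{Sp}^1(F,\mathrm{id})(X,S)=(FX,\{Fk\mid k\in S\})$, and $R^{Q}_q(Y,S)=\bigwedge_{k\in S}k^*Q$. -}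

module Defs where

open import Level using (Level; _⊔_; suc)
open import Data.Product using (Σ; _,_; proj₁; proj₂)
open import Relation.Binary.PropositionalEquality using (_≡_)
open import Function using (_∘′_)

record Category (o ℓ : Level) : Set (suc (o ⊔ ℓ)) where
  infixr 9 _∘_
  field
    Obj  : Set o
    Hom  : Obj → Obj → Set ℓ
    id   : ∀ {X} → Hom X X
    _∘_  : ∀ {X Y Z} → Hom Y Z → Hom X Y → Hom X Z
    identityˡ : ∀ {X Y} (f : Hom X Y) → id ∘ f ≡ f
    identityʳ : ∀ {X Y} (f : Hom X Y) → f ∘ id ≡ f
    assoc     : ∀ {W X Y Z} (h : Hom Y Z) (g : Hom X Y) (f : Hom W X) →
                (h ∘ g) ∘ f ≡ h ∘ (g ∘ f)

record Functor {o ℓ o' ℓ'} (B : Category o ℓ) (C : Category o' ℓ')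
       : Set (o ⊔ ℓ ⊔ o' ⊔ ℓ') where
  private
    module B = Category B
    module C = Category C
  field
    F₀ : B.Obj → C.Obj
    F₁ : ∀ {X Y} → B.Hom X Y → C.Hom (F₀ X) (F₀ Y)
    F-id : ∀ {X} → F₁ (B.id {X}) ≡ C.id
    F-∘  : ∀ {X Y Z} (g : B.Hom Y Z) (f : B.Hom X Y) →
           F₁ (g B.∘ f) ≡ F₁ g C.∘ F₁ f

-- A CLat_⊓-fibration over B, presented by its fibres: each fibre is a
-- complete lattice (partial order ⊑ with meets ⋀ of all families indexed
-- by types of level ι), and reindexing f* is meet-preserving and
-- (pseudo)functorial; since fibres are posets, pseudofunctoriality is
-- equality.  The total category 𝔼 is the Grothendieck construction below.
record CLatFib {o ℓ} (B : Category o ℓ) (e r ι : Level)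
       : Set (o ⊔ ℓ ⊔ suc (e ⊔ r ⊔ ι)) where
  open Category B
  field
    Fib   : Obj → Set e
    _⊑_   : ∀ {X} → Fib X → Fib X → Set r
    ⊑-refl    : ∀ {X} {P : Fib X} → P ⊑ P
    ⊑-trans   : ∀ {X} {P Q R : Fib X} → P ⊑ Q → Q ⊑ R → P ⊑ R
    ⊑-antisym : ∀ {X} {P Q : Fib X} → P ⊑ Q → Q ⊑ P → P ≡ Q
    ⋀     : ∀ {X} {I : Set ι} → (I → Fib X) → Fib X
    ⋀-lower    : ∀ {X} {I : Set ι} (h : I → Fib X) (i : I) → ⋀ h ⊑ h i
    ⋀-greatest : ∀ {X} {I : Set ι} (h : I → Fib X) (P : Fib X) →
                 (∀ i → P ⊑ h i) → P ⊑ ⋀ h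
    _*    : ∀ {X Y} → Hom X Y → Fib Y → Fib X
    *-mono : ∀ {X Y} (f : Hom X Y) {P Q : Fib Y} → P ⊑ Q → (f *) P ⊑ (f *) Q
    *-id   : ∀ {X} (P : Fib X) → (id *) P ≡ P
    *-∘    : ∀ {X Y Z} (g : Hom Y Z) (f : Hom X Y) (P : Fib Z) →
             ((g ∘ f) *) P ≡ (f *) ((g *) P)
    *-⋀    : ∀ {X Y} (f : Hom X Y) {I : Set ι} (h : I → Fib Y) →
             (f *) (⋀ h) ≡ ⋀ (λ i → (f *) (h i))

  TotObj : Set (o ⊔ e)
  TotObj = Σ Obj Fib

  p₀ : TotObj → Obj
  p₀ = proj₁

  TotHom : TotObj → TotObj → Set (ℓ ⊔ r)
  TotHom (X , P) (Y , Q) = Σ (Hom X Y) (λ f → P ⊑ (f *) Q)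

  p₁ : ∀ {A A'} → TotHom A A' → Hom (p₀ A) (p₀ A')
  p₁ = proj₁

module _ {oB ℓB oC ℓC eE rE ιE eF rF}
         {B : Category oB ℓB} {C : Category oC ℓC}
         (E : CLatFib B eE rE ιE) (Fq : CLatFib C eF rF (ℓB ⊔ rE))
         (F : Functor B C) where
  private
    module B = Category B
    module C = Category C
    module E = CLatFib E
    module Q = CLatFib Fq
  open Functor F

  -- Codensity lifting F^{Ω,Π}_τ, for truth values (O,Ω) in 𝔼 and (O',Π) in 𝔽
  -- (indexed by A = 1) and τ : F O → O'.  Lies over F(pP).
  codensityLifting : (O : B.Obj) (Ω : E.Fib O) (O' : C.Obj) (Π : Q.Fib O')
                     (τ : C.Hom (F₀ O) O') →
                     (P : E.TotObj) → Q.Fib (F₀ (E.p₀ P))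
  codensityLifting O Ω O' Π τ P =
    Q.⋀ {I = E.TotHom P (O , Ω)} (λ k → ((τ C.∘ F₁ (E.p₁ k)) Q.*) Π)

  -- Families of morphisms into a fixed codomain ("sets" {k}), indexed by a type.
  record Sieve {o ℓ} (K : Category o ℓ) (T : Category.Obj K) (X : Category.Obj K)
         (ι : Level) : Set (ℓ ⊔ suc ι) where
    field
      Idx : Set ι
      arr : Idx → Category.Hom K X T

  Lp : (O : B.Obj) (Ω : E.Fib O) (P : E.TotObj) →
       Sieve B O (E.p₀ P) (ℓB ⊔ rE)
  Lp O Ω P = record { Idx = E.TotHom P (O , Ω) ; arr = E.p₁ }

  Sp1 : ∀ {O X} → Sieve B O X (ℓB ⊔ rE) → Sieve C (F₀ O) (F₀ X) (ℓB ⊔ rE)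
  Sp1 S = record { Idx = Sieve.Idx S ; arr = λ i → F₁ (Sieve.arr S i) }

  Rq : ∀ {T Y} (Qt : Q.Fib T) → Sieve C T Y (ℓB ⊔ rE) → Q.Fib Y
  Rq Qt S = Q.⋀ {I = Sieve.Idx S} (λ i → (Sieve.arr S i Q.*) Qt)

-- Reindexing the codensity lifting at Ω along F(pk) gives the meet of
-- (τ ∘ F(pj ∘ pk))* Π over all j : Ω → Ω in 𝔼.  Since j ∘ k ranges inside
-- 𝔼(P, Ω), this meet lies above F^{Ω,Π}_τ(P); taking j = id shows it lies
-- below (τ ∘ F(pk))* Π.  Meeting over k gives both inequalities.
module Submission where

open import Defs
open import Level using (_⊔_)
open import Data.Product using (_×_; _,_)
open import Relation.Binary.PropositionalEquality
  using (_≡_; refl; sym; trans; cong; module ≡-Reasoning)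

module FibreOrder {o ℓ e r ι} {B : Category o ℓ} (E : CLatFib B e r ι) where
  open CLatFib E

  ≡⇒⊑ : ∀ {X} {P Q : Fib X} → P ≡ Q → P ⊑ Q
  ≡⇒⊑ refl = ⊑-refl

module TotalCategory {o ℓ e r ι} {B : Category o ℓ} (E : CLatFib B e r ι) where
  open Category B
  open CLatFib E
  open FibreOrder E

  idᵗ : ∀ {A} → TotHom A A
  idᵗ {X , P} = id , ≡⇒⊑ (sym (*-id P))

  infixr 9 _∘ᵗ_
  _∘ᵗ_ : ∀ {A₁ A₂ A₃} → TotHom A₂ A₃ → TotHom A₁ A₂ → TotHom A₁ A₃
  _∘ᵗ_ {A₃ = _ , R} (g , Q⊑g*R) (f , P⊑f*Q) =
    g ∘ f , ⊑-trans P⊑f*Q (⊑-trans (*-mono f Q⊑g*R) (≡⇒⊑ (sym (*-∘ g f R))))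

module _ {oB ℓB oC ℓC eE rE ιE eF rF}
         {B : Category oB ℓB} {C : Category oC ℓC}
         (E : CLatFib B eE rE ιE) (Fq : CLatFib C eF rF (ℓB ⊔ rE))
         (F : Functor B C)
         (O : Category.Obj B) (Ω : CLatFib.Fib E O)
         (O' : Category.Obj C) (Π : CLatFib.Fib Fq O')
         (τ : Category.Hom C (Functor.F₀ F O) O') where
  private
    module B = Category B
    module C = Category C
    module E = CLatFib E
    module Q = CLatFib Fq
  open Functor F
  open TotalCategory E using (idᵗ; _∘ᵗ_)
  open FibreOrder Fq using (≡⇒⊑)

  private
    L : (P : E.TotObj) → Q.Fib (F₀ (E.p₀ P))
    L = codensityLifting E Fq F O Ω O' Π τ

  reindex-τF : ∀ {X Y} (g : B.Hom Y O) (f : B.Hom X Y) →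
               (F₁ f Q.*) (((τ C.∘ F₁ g) Q.*) Π) ≡ ((τ C.∘ F₁ (g B.∘ f)) Q.*) Π
  reindex-τF g f = begin
    (F₁ f Q.*) (((τ C.∘ F₁ g) Q.*) Π)   ≡⟨ sym (Q.*-∘ (τ C.∘ F₁ g) (F₁ f) Π) ⟩
    (((τ C.∘ F₁ g) C.∘ F₁ f) Q.*) Π     ≡⟨ cong (λ h → (h Q.*) Π) (C.assoc τ (F₁ g) (F₁ f)) ⟩
    ((τ C.∘ (F₁ g C.∘ F₁ f)) Q.*) Π     ≡⟨ cong (λ h → ((τ C.∘ h) Q.*) Π) (sym (F-∘ g f)) ⟩
    ((τ C.∘ F₁ (g B.∘ f)) Q.*) Π        ∎
    where open ≡-Reasoning

  codensityLifting-⊑-reindex : (P : E.TotObj) (k : E.TotHom P (O , Ω)) →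
                               L P Q.⊑ (F₁ (E.p₁ k) Q.*) (L (O , Ω))
  codensityLifting-⊑-reindex P k =
    Q.⊑-trans
      (Q.⋀-greatest _ _ λ j →
        Q.⊑-trans (Q.⋀-lower _ (j ∘ᵗ k)) (≡⇒⊑ (sym (reindex-τF (E.p₁ j) (E.p₁ k)))))
      (≡⇒⊑ (sym (Q.*-⋀ (F₁ (E.p₁ k)) _)))

  reindex-codensityLifting-⊑ : (P : E.TotObj) (k : E.TotHom P (O , Ω)) →
                            (F₁ (E.p₁ k) Q.*) (L (O , Ω))
                              Q.⊑ ((τ C.∘ F₁ (E.p₁ k)) Q.*) Π
  reindex-codensityLifting-⊑ P k =
    Q.⊑-trans (≡⇒⊑ (Q.*-⋀ (F₁ (E.p₁ k)) _))
      (Q.⊑-trans (Q.⋀-lower _ idᵗ)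
        (≡⇒⊑ (trans (reindex-τF B.id (E.p₁ k))
                    (cong (λ h → ((τ C.∘ F₁ h) Q.*) Π) (B.identityˡ (E.p₁ k))))))

  codensityLifting-as-meet : (P : E.TotObj) →
    L P ≡ Q.⋀ {I = E.TotHom P (O , Ω)} (λ k → (F₁ (E.p₁ k) Q.*) (L (O , Ω)))
  codensityLifting-as-meet P = Q.⊑-antisym
    (Q.⋀-greatest _ _ (codensityLifting-⊑-reindex P))
    (Q.⋀-greatest _ _ λ k → Q.⊑-trans (Q.⋀-lower _ k) (reindex-codensityLifting-⊑ P k))

proposition1 : ∀ {oB ℓB oC ℓC eE rE ιE eF rF}
    {B : Category oB ℓB} {C : Category oC ℓC}
    (E : CLatFib B eE rE ιE) (Fq : CLatFib C eF rF (ℓB ⊔ rE))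
    (F : Functor B C)
    (O : Category.Obj B) (Ω : CLatFib.Fib E O)
    (O' : Category.Obj C) (Π : CLatFib.Fib Fq O')
    (τ : Category.Hom C (Functor.F₀ F O) O') →
    (P : CLatFib.TotObj E) →
    (codensityLifting E Fq F O Ω O' Π τ P
    ≡ CLatFib.⋀ Fq {I = CLatFib.TotHom E P (O , Ω)}
    (λ k → CLatFib._* Fq (Functor.F₁ F (CLatFib.p₁ E k))
    (codensityLifting E Fq F O Ω O' Π τ (O , Ω))))
    × (codensityLifting E Fq F O Ω O' Π τ P
    ≡ Rq E Fq F (codensityLifting E Fq F O Ω O' Π τ (O , Ω))
    (Sp1 E Fq F (Lp E Fq F O Ω P)))
-- The composite R ∘ Sp¹ ∘ L unfolds definitionally to the same meet.
proposition1 E Fq F O Ω O' Π τ P =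
  codensityLifting-as-meet E Fq F O Ω O' Π τ P ,
  codensityLifting-as-meet E Fq F O Ω O' Π τ P
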